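{- The logic $\mathcal{B}$ enjoys interpolation. The logic $\mathcal{K}$ enjoys $(\mathcal{K},\mathcal{B})$-interpolation. The logic $\mathcal{ETL}$ enjoys $(\mathcal{ETL},\mathcal{B})$-interpolation.
   Context: Formulas are built from atoms using $\wedge,\vee$, unary ${ - }$ and constants $\top,\bot$. A matrix $\langle A,F\rangle$ (algebra $A$, $F\subseteq A$) determines the logic where $\Gamma\vdash\varphi$ iff for every homomorphism $v$ from the formula algebra to $A$, $v[\Gamma]\subseteq F$ implies $v(\varphi)\in F$. Let $\mathbf{B_4}$ be the algebra on $\{f,n,b,t\}$ with lattice order $f<n<t$, $f<b<t$ ($n,b$ incomparable), $\wedge,\vee$ meet and join, $\top=t$, $\bot=f$, ${ - }t=f$, ${ - }f=t$, ${ - }n=n$, ${ - }b=b$. $\mathcal{B}$ is the logic of $\langle\mathbf{B_4},\{t,b\}\rangle$; $\mathcal{ETL}$ is the logic of $\langle\mathbf{B_4},\{t\}\rangle$; $\mathcal{K}$ is the logic of the subalgebra on $\{f,n,t\}$ with designated set $\{t\}$. A logic $\mathcal{L}$ has interpolation if whenever $\varphi\vdash_{\mathcal{L}}\psi$ there is a formula $\chi$ with $\varphi\vdash_{\mathcal{L}}\chi$, $\chi\vdash_{\mathcal{L}}\psi$, and every atom of $\chi$ occurs in both $\varphi$ and $\psi$. For logics $\mathcal{L}_1,\mathcal{L}_2\subseteq\mathcal{L}$, $\mathcal{L}$ has $(\mathcal{L}_1,\mathcal{L}_2)$-interpolation if whenever $\varphi\vdash_{\mathcal{L}}\psi$ there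 is $\chi$ with $\varphi\vdash_{\mathcal{L}_1}\chi$, $\chi\vdash_{\mathcal{L}_2}\psi$, and every atom of $\chi$ occurs in both $\varphi$ and $\psi$. -}

module Defs where

open import Data.Nat using (ℕ)
open import Data.Product using (Σ; _×_; ∃)
open import Data.Sum using (_⊎_)
open import Data.Empty using (⊥)
open import Relation.Binary.PropositionalEquality using (_≡_)

data Fm : Set where
  atom : ℕ → Fm
  _∧'_ : Fm → Fm → Fm
  _∨'_ : Fm → Fm → Fm
  ∼_   : Fm → Fm
  top  : Fm
  bot  : Fm

Occurs : ℕ → Fm → Set
Occurs p (atom q) = p ≡ q
Occurs p (φ ∧' ψ) = Occurs p φ ⊎ Occurs p ψ
Occurs p (φ ∨' ψ) = Occurs p φ ⊎ Occurs p ψ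
Occurs p (∼ φ)    = Occurs p φ
Occurs p top      = ⊥
Occurs p bot      = ⊥

-- The algebra B4 on {f, n, b, t}: f < n < t, f < b < t, n ∥ b

data B4 : Set where
  f n b t : B4

_⊓_ : B4 → B4 → B4
f ⊓ y = f
t ⊓ y = y
n ⊓ f = f
n ⊓ n = n
n ⊓ b = f
n ⊓ t = n
b ⊓ f = f
b ⊓ n = f
b ⊓ b = b
b ⊓ t = b

_⊔_ : B4 → B4 → B4
t ⊔ y = t
f ⊔ y = y
n ⊔ f = n
n ⊔ n = n
n ⊔ b = t
n ⊔ t = t
b ⊔ f = b
b ⊔ n = t
b ⊔ b = b
b ⊔ t = t

neg : B4 → B4
neg f = t
neg n = n
neg b = b
neg t = f

-- Homomorphic extension of an atom assignment (every homomorphism from the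
-- formula algebra is of this form)
⟦_⟧ : Fm → (ℕ → B4) → B4
⟦ atom p ⟧ v = v p
⟦ φ ∧' ψ ⟧ v = ⟦ φ ⟧ v ⊓ ⟦ ψ ⟧ v
⟦ φ ∨' ψ ⟧ v = ⟦ φ ⟧ v ⊔ ⟦ ψ ⟧ v
⟦ ∼ φ ⟧ v    = neg (⟦ φ ⟧ v)
⟦ top ⟧ v    = t
⟦ bot ⟧ v    = f

DesB : B4 → Set
DesB x = (x ≡ t) ⊎ (x ≡ b)

DesT : B4 → Set
DesT x = x ≡ t

InK3 : B4 → Set
InK3 x = (x ≡ f) ⊎ ((x ≡ n) ⊎ (x ≡ t))

_⊢B_ : Fm → Fm → Set
φ ⊢B ψ = (v : ℕ → B4) → DesB (⟦ φ ⟧ v) → DesB (⟦ ψ ⟧ v)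

_⊢ETL_ : Fm → Fm → Set
φ ⊢ETL ψ = (v : ℕ → B4) → DesT (⟦ φ ⟧ v) → DesT (⟦ ψ ⟧ v)

-- logic K of ⟨{f,n,t}, {t}⟩: homomorphisms into the subalgebra are exactly
-- the homomorphic extensions of atom assignments with values in {f,n,t}
_⊢K_ : Fm → Fm → Set
φ ⊢K ψ = (v : ℕ → B4) → ((p : ℕ) → InK3 (v p)) →
         DesT (⟦ φ ⟧ v) → DesT (⟦ ψ ⟧ v)

-- (L1, L2)-interpolation for L (plain interpolation: L1 = L2 = L)

Interpolation : (L L₁ L₂ : Fm → Fm → Set) → Set
Interpolation L L₁ L₂ =
  (φ ψ : Fm) → L φ ψ →
  Σ Fm (λ χ → L₁ φ χ × L₂ χ ψ ×
              ((p : ℕ) → Occurs p χ → Occurs p φ × Occurs p ψ))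

module Submission where

-- Read x ∈ B4 as the pair (truth x, falsity x) of "told true" and "told false".
-- Then ⊓ and ⊔ act componentwise as (∧, ∨) and (∨, ∧) and neg swaps the components, so
-- all operations are monotone for the componentwise knowledge order ≤ₖ, in which n is
-- least; and the B-designated values {t, b} are exactly the told-true ones.
-- For φ ⊢ ψ the interpolant is the disjunction, over the assignments y to the atoms of φ
-- with values in a finite set O making φ designated in the source logic, of the
-- conditions y p ≤ₖ x p at the shared atoms p (each one of p, ∼ p, p ∧ ∼ p, ⊤).
-- φ entails it through the disjunct y = x. Conversely, if it is B-designated at x, some
-- such y, set to n elsewhere, lies ≤ₖ-below x on the atoms of ψ; ψ is designated at y by
-- hypothesis, hence at x by monotonicity.
-- For K take O = {f, n, t}: these values are consistent, and a consistent told-true value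
-- is t. For ETL take O = B4: B-designation of the interpolant at x and at its image under
-- the automorphism exchanging n and b forces the value t.

open import Defs
open import Data.Bool using (Bool; true; false; T; _∧_; _∨_)
open import Data.Bool.Properties using (T-∧; T-∨)
open import Data.Empty using (⊥-elim)
open import Data.List using (List; []; _∷_; _++_; map; foldr)
open import Data.List.Relation.Unary.Any using (Any; here; there)
open import Data.List.Relation.Unary.Any.Properties using (map⁺; map⁻)
open import Data.List.Membership.Propositional using (_∈_; _∉_; find; lose)
open import Data.List.Membership.Propositional.Properties using (∈-++⁺ˡ; ∈-++⁺ʳ; ∈-++⁻)
open import Data.Nat using (ℕ; _≟_)
open import Data.List.Membership.DecPropositional _≟_ using (_∈?_)
open import Data.Product using (Σ; _×_; _,_; proj₁; proj₂)
import Data.Product as Product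
open import Data.Sum using (_⊎_; inj₁; inj₂)
import Data.Sum as Sum
open import Function using (_∘_)
open import Function.Bundles using (_⇔_; Equivalence)
open import Relation.Nullary using (¬_; Dec; yes; no)
open import Relation.Unary using (Decidable)
open import Relation.Binary.PropositionalEquality using (_≡_; refl; sym; trans; cong; cong₂; subst)

open Equivalence using (to; from)

truth : B4 → Bool
truth f = false
truth n = false
truth b = true
truth t = true

falsity : B4 → Bool
falsity f = true
falsity n = false
falsity b = true
falsity t = false

truth-⊓ : ∀ x y → truth (x ⊓ y) ≡ truth x ∧ truth y
truth-⊓ f _ = refl
truth-⊓ t _ = refl
truth-⊓ n f = refl
truth-⊓ n n = refl
truth-⊓ n b = refl
truth-⊓ n t = refl
truth-⊓ b f = refl
truth-⊓ b n = refl
truth-⊓ b b = refl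
truth-⊓ b t = refl

falsity-⊓ : ∀ x y → falsity (x ⊓ y) ≡ falsity x ∨ falsity y
falsity-⊓ f _ = refl
falsity-⊓ t _ = refl
falsity-⊓ n f = refl
falsity-⊓ n n = refl
falsity-⊓ n b = refl
falsity-⊓ n t = refl
falsity-⊓ b f = refl
falsity-⊓ b n = refl
falsity-⊓ b b = refl
falsity-⊓ b t = refl

truth-⊔ : ∀ x y → truth (x ⊔ y) ≡ truth x ∨ truth y
truth-⊔ f _ = refl
truth-⊔ t _ = refl
truth-⊔ n f = refl
truth-⊔ n n = refl
truth-⊔ n b = refl
truth-⊔ n t = refl
truth-⊔ b f = refl
truth-⊔ b n = refl
truth-⊔ b b = refl
truth-⊔ b t = refl

falsity-⊔ : ∀ x y → falsity (x ⊔ y) ≡ falsity x ∧ falsity y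
falsity-⊔ f _ = refl
falsity-⊔ t _ = refl
falsity-⊔ n f = refl
falsity-⊔ n n = refl
falsity-⊔ n b = refl
falsity-⊔ n t = refl
falsity-⊔ b f = refl
falsity-⊔ b n = refl
falsity-⊔ b b = refl
falsity-⊔ b t = refl

truth-neg : ∀ x → truth (neg x) ≡ falsity x
truth-neg f = refl
truth-neg n = refl
truth-neg b = refl
truth-neg t = refl

falsity-neg : ∀ x → falsity (neg x) ≡ truth x
falsity-neg f = refl
falsity-neg n = refl
falsity-neg b = refl
falsity-neg t = refl

T-truth-⊓ : ∀ x y → T (truth (x ⊓ y)) ⇔ (T (truth x) × T (truth y))
T-truth-⊓ x y rewrite truth-⊓ x y = T-∧

T-falsity-⊓ : ∀ x y → T (falsity (x ⊓ y)) ⇔ (T (falsity x) ⊎ T (falsity y))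
T-falsity-⊓ x y rewrite falsity-⊓ x y = T-∨

T-truth-⊔ : ∀ x y → T (truth (x ⊔ y)) ⇔ (T (truth x) ⊎ T (truth y))
T-truth-⊔ x y rewrite truth-⊔ x y = T-∨

T-falsity-⊔ : ∀ x y → T (falsity (x ⊔ y)) ⇔ (T (falsity x) × T (falsity y))
T-falsity-⊔ x y rewrite falsity-⊔ x y = T-∧

DesB⇒truth : ∀ {x} → DesB x → T (truth x)
DesB⇒truth (inj₁ refl) = _
DesB⇒truth (inj₂ refl) = _

truth⇒DesB : ∀ x → T (truth x) → DesB x
truth⇒DesB b _ = inj₂ refl
truth⇒DesB t _ = inj₁ refl

infix 4 _≤ₖ_

record _≤ₖ_ (x y : B4) : Set where
  constructor mk≤ₖ
  field
    truth-≤ₖ : T (truth x) → T (truth y)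
    falsity-≤ₖ : T (falsity x) → T (falsity y)

n≤ₖ : ∀ {x} → n ≤ₖ x
n≤ₖ = mk≤ₖ (λ ()) (λ ())

≤ₖ-refl : ∀ {x} → x ≤ₖ x
≤ₖ-refl = mk≤ₖ (λ h → h) (λ h → h)

⊓-monoₖ : ∀ {x x′ y y′} → x ≤ₖ x′ → y ≤ₖ y′ → x ⊓ y ≤ₖ x′ ⊓ y′
⊓-monoₖ {x} {x′} {y} {y′} (mk≤ₖ tx fx) (mk≤ₖ ty fy) = mk≤ₖ
  (from (T-truth-⊓ x′ y′) ∘ Product.map tx ty ∘ to (T-truth-⊓ x y))
  (from (T-falsity-⊓ x′ y′) ∘ Sum.map fx fy ∘ to (T-falsity-⊓ x y))

⊔-monoₖ : ∀ {x x′ y y′} → x ≤ₖ x′ → y ≤ₖ y′ → x ⊔ y ≤ₖ x′ ⊔ y′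
⊔-monoₖ {x} {x′} {y} {y′} (mk≤ₖ tx fx) (mk≤ₖ ty fy) = mk≤ₖ
  (from (T-truth-⊔ x′ y′) ∘ Sum.map tx ty ∘ to (T-truth-⊔ x y))
  (from (T-falsity-⊔ x′ y′) ∘ Product.map fx fy ∘ to (T-falsity-⊔ x y))

neg-monoₖ : ∀ {x y} → x ≤ₖ y → neg x ≤ₖ neg y
neg-monoₖ {x} {y} (mk≤ₖ tx fx) = mk≤ₖ
  (subst T (sym (truth-neg y)) ∘ fx ∘ subst T (truth-neg x))
  (subst T (sym (falsity-neg y)) ∘ tx ∘ subst T (falsity-neg x))

⟦⟧-cong : ∀ φ {v w : ℕ → B4} → (∀ q → Occurs q φ → v q ≡ w q) → ⟦ φ ⟧ v ≡ ⟦ φ ⟧ w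
⟦⟧-cong (atom p) h = h p refl
⟦⟧-cong (φ ∧' ψ) h = cong₂ _⊓_ (⟦⟧-cong φ (λ q → h q ∘ inj₁)) (⟦⟧-cong ψ (λ q → h q ∘ inj₂))
⟦⟧-cong (φ ∨' ψ) h = cong₂ _⊔_ (⟦⟧-cong φ (λ q → h q ∘ inj₁)) (⟦⟧-cong ψ (λ q → h q ∘ inj₂))
⟦⟧-cong (∼ φ) h = cong neg (⟦⟧-cong φ h)
⟦⟧-cong top h = refl
⟦⟧-cong bot h = refl

⟦⟧-monoₖ : ∀ φ {v w : ℕ → B4} → (∀ q → Occurs q φ → v q ≤ₖ w q) → ⟦ φ ⟧ v ≤ₖ ⟦ φ ⟧ w
⟦⟧-monoₖ (atom p) h = h p refl
⟦⟧-monoₖ (φ ∧' ψ) h = ⊓-monoₖ (⟦⟧-monoₖ φ (λ q → h q ∘ inj₁)) (⟦⟧-monoₖ ψ (λ q → h q ∘ inj₂))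
⟦⟧-monoₖ (φ ∨' ψ) h = ⊔-monoₖ (⟦⟧-monoₖ φ (λ q → h q ∘ inj₁)) (⟦⟧-monoₖ ψ (λ q → h q ∘ inj₂))
⟦⟧-monoₖ (∼ φ) h = neg-monoₖ (⟦⟧-monoₖ φ h)
⟦⟧-monoₖ top h = ≤ₖ-refl
⟦⟧-monoₖ bot h = ≤ₖ-refl

DesB-monoₖ : ∀ {x y} → x ≤ₖ y → DesB x → DesB y
DesB-monoₖ {y = y} (mk≤ₖ tx _) = truth⇒DesB y ∘ tx ∘ DesB⇒truth

infix 4 _⊨_

_⊨_ : (ℕ → B4) → Fm → Set
v ⊨ φ = T (truth (⟦ φ ⟧ v))

guard : ℕ → B4 → Fm
guard p f = ∼ atom p
guard p n = top
guard p b = atom p ∧' (∼ atom p)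
guard p t = atom p

guard-sound : ∀ p c {x} → x ⊨ guard p c → c ≤ₖ x p
guard-sound p f {x} h = mk≤ₖ (λ ()) (λ _ → subst T (truth-neg (x p)) h)
guard-sound p n h = n≤ₖ
guard-sound p b {x} h with to (T-truth-⊓ (x p) (neg (x p))) h
... | h₁ , h₂ = mk≤ₖ (λ _ → h₁) (λ _ → subst T (truth-neg (x p)) h₂)
guard-sound p t h = mk≤ₖ (λ _ → h) (λ ())

guard-complete : ∀ p c {x} → c ≤ₖ x p → x ⊨ guard p c
guard-complete p f {x} (mk≤ₖ _ fx) = subst T (sym (truth-neg (x p))) (fx _)
guard-complete p n _ = _
guard-complete p b {x} (mk≤ₖ tx fx) =
  from (T-truth-⊓ (x p) (neg (x p))) (tx _ , subst T (sym (truth-neg (x p))) (fx _))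
guard-complete p t (mk≤ₖ tx _) = tx _

guard-atoms : ∀ p c {q} → Occurs q (guard p c) → q ≡ p
guard-atoms p f o = o
guard-atoms p b (inj₁ o) = o
guard-atoms p b (inj₂ o) = o
guard-atoms p t o = o

⋁ : List Fm → Fm
⋁ = foldr _∨'_ bot

⊨-⋁⁺ : ∀ {v} φs → Any (v ⊨_) φs → v ⊨ ⋁ φs
⊨-⋁⁺ {v} (φ ∷ φs) h = from (T-truth-⊔ (⟦ φ ⟧ v) (⟦ ⋁ φs ⟧ v)) (step h)
  where
  step : Any (v ⊨_) (φ ∷ φs) → v ⊨ φ ⊎ v ⊨ ⋁ φs
  step (here h) = inj₁ h
  step (there h) = inj₂ (⊨-⋁⁺ φs h)

⊨-⋁⁻ : ∀ {v} φs → v ⊨ ⋁ φs → Any (v ⊨_) φs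
⊨-⋁⁻ {v} (φ ∷ φs) h with to (T-truth-⊔ (⟦ φ ⟧ v) (⟦ ⋁ φs ⟧ v)) h
... | inj₁ h = here h
... | inj₂ h = there (⊨-⋁⁻ φs h)

⋁-atoms : ∀ φs {q} → Occurs q (⋁ φs) → Any (Occurs q) φs
⋁-atoms (φ ∷ φs) (inj₁ o) = here o
⋁-atoms (φ ∷ φs) (inj₂ o) = there (⋁-atoms φs o)

atoms : Fm → List ℕ
atoms (atom p) = p ∷ []
atoms (φ ∧' ψ) = atoms φ ++ atoms ψ
atoms (φ ∨' ψ) = atoms φ ++ atoms ψ
atoms (∼ φ) = atoms φ
atoms top = []
atoms bot = []

∈-atoms⁺ : ∀ φ {q} → Occurs q φ → q ∈ atoms φ
∈-atoms⁺ (atom p) o = here o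
∈-atoms⁺ (φ ∧' ψ) (inj₁ o) = ∈-++⁺ˡ (∈-atoms⁺ φ o)
∈-atoms⁺ (φ ∧' ψ) (inj₂ o) = ∈-++⁺ʳ (atoms φ) (∈-atoms⁺ ψ o)
∈-atoms⁺ (φ ∨' ψ) (inj₁ o) = ∈-++⁺ˡ (∈-atoms⁺ φ o)
∈-atoms⁺ (φ ∨' ψ) (inj₂ o) = ∈-++⁺ʳ (atoms φ) (∈-atoms⁺ ψ o)
∈-atoms⁺ (∼ φ) o = ∈-atoms⁺ φ o

∈-atoms⁻ : ∀ φ {q} → q ∈ atoms φ → Occurs q φ
∈-atoms⁻ (atom p) (here e) = e
∈-atoms⁻ (φ ∧' ψ) m = Sum.map (∈-atoms⁻ φ) (∈-atoms⁻ ψ) (∈-++⁻ (atoms φ) m)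
∈-atoms⁻ (φ ∨' ψ) m = Sum.map (∈-atoms⁻ φ) (∈-atoms⁻ ψ) (∈-++⁻ (atoms φ) m)
∈-atoms⁻ (∼ φ) m = ∈-atoms⁻ φ m

_[_≔_] : (ℕ → B4) → ℕ → B4 → ℕ → B4
(y [ p ≔ c ]) q with q ≟ p
... | yes _ = c
... | no _ = y q

truthConstant : ∀ {P : Set} → Dec P → Fm
truthConstant (yes _) = top
truthConstant (no _) = bot

⊨-truthConstant⁺ : ∀ {P : Set} {v} (d : Dec P) → P → v ⊨ truthConstant d
⊨-truthConstant⁺ (yes _) _ = _
⊨-truthConstant⁺ (no ¬p) p = ¬p p

⊨-truthConstant⁻ : ∀ {P : Set} {v} (d : Dec P) → v ⊨ truthConstant d → P
⊨-truthConstant⁻ (yes p) _ = p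

truthConstant-atoms : ∀ {P : Set} {q} (d : Dec P) → ¬ Occurs q (truthConstant d)
truthConstant-atoms (yes _) ()
truthConstant-atoms (no _) ()

module Interpolant (O : List B4) {D : B4 → Set} (D? : Decidable D) (φ ψ : Fm) where

  guardIfShared : ℕ → B4 → Fm
  guardIfShared p c with p ∈? atoms ψ
  ... | yes _ = guard p c
  ... | no _ = top

  guardIfShared-sound : ∀ p c {x} → x ⊨ guardIfShared p c → Occurs p ψ → c ≤ₖ x p
  guardIfShared-sound p c h o with p ∈? atoms ψ
  ... | yes _ = guard-sound p c h
  ... | no p∉ψ = ⊥-elim (p∉ψ (∈-atoms⁺ ψ o))

  guardIfShared-complete : ∀ p {x} → x ⊨ guardIfShared p (x p)
  guardIfShared-complete p {x} with p ∈? atoms ψ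
  ... | yes _ = guard-complete p (x p) {x} ≤ₖ-refl
  ... | no _ = _

  guardIfShared-atoms : ∀ p c {q} → Occurs q (guardIfShared p c) → q ≡ p × Occurs q ψ
  guardIfShared-atoms p c o with p ∈? atoms ψ
  ... | yes p∈ψ with refl ← guard-atoms p c o = refl , ∈-atoms⁻ ψ p∈ψ

  -- expand ps y is the disjunction, over the redefinitions y′ of y on ps with values in O
  -- and D (⟦ φ ⟧ y′), of the guards y′ p ≤ₖ x p at the shared atoms p of ps.
  expand : List ℕ → (ℕ → B4) → Fm
  branch : ℕ → List ℕ → (ℕ → B4) → B4 → Fm

  expand [] y = truthConstant (D? (⟦ φ ⟧ y))
  expand (p ∷ ps) y = ⋁ (map (branch p ps y) O)

  branch p ps y c = guardIfShared p c ∧' expand ps (y [ p ≔ c ])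

  Approximates : (x y : ℕ → B4) → Set
  Approximates x y = ∀ q → y q ∈ n ∷ O × (Occurs q ψ → y q ≤ₖ x q)

  approximates-≔ : ∀ {x y p c} → Approximates x y → c ∈ O → (Occurs p ψ → c ≤ₖ x p) →
                   Approximates x (y [ p ≔ c ])
  approximates-≔ {p = p} a c∈O c≤x q with q ≟ p
  ... | yes refl = there c∈O , c≤x
  ... | no _ = a q

  expand-sound : ∀ ps {x y} → Approximates x y → x ⊨ expand ps y →
                 Σ (ℕ → B4) λ y′ → Approximates x y′ × D (⟦ φ ⟧ y′)
  expand-sound [] {y = y} a h = y , a , ⊨-truthConstant⁻ (D? _) h
  expand-sound (p ∷ ps) {x} {y} a h
    with c , c∈O , hc ← find (map⁻ (⊨-⋁⁻ (map (branch p ps y) O) h))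
    with hg , he ← to (T-truth-⊓ (⟦ guardIfShared p c ⟧ x) _) hc
    = expand-sound ps (approximates-≔ a c∈O (guardIfShared-sound p c hg)) he

  expand-complete : ∀ ps {x y} → (∀ q → x q ∈ O) → (∀ q → Occurs q φ → q ∉ ps → y q ≡ x q) →
                    D (⟦ φ ⟧ x) → x ⊨ expand ps y
  expand-complete [] x∈O y≡x d =
    ⊨-truthConstant⁺ (D? _) (subst D (⟦⟧-cong φ (λ q o → sym (y≡x q o λ ()))) d)
  expand-complete (p ∷ ps) {x} {y} x∈O y≡x d =
    ⊨-⋁⁺ _ (map⁺ (lose (x∈O p) (from (T-truth-⊓ _ _) (guardIfShared-complete p , rest))))
    where
    y[p≔xp]≡x : ∀ q → Occurs q φ → q ∉ ps → (y [ p ≔ x p ]) q ≡ x q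
    y[p≔xp]≡x q o q∉ps with q ≟ p
    ... | yes refl = refl
    ... | no q≢p = y≡x q o λ { (here q≡p) → q≢p q≡p ; (there q∈ps) → q∉ps q∈ps }
    rest : x ⊨ expand ps (y [ p ≔ x p ])
    rest = expand-complete ps x∈O y[p≔xp]≡x d

  expand-atoms : ∀ ps y {q} → Occurs q (expand ps y) → q ∈ ps × Occurs q ψ
  expand-atoms [] y o = ⊥-elim (truthConstant-atoms (D? _) o)
  expand-atoms (p ∷ ps) y o with _ , _ , oc ← find (map⁻ (⋁-atoms (map (branch p ps y) O) o)) with oc
  ... | inj₁ og = Product.map₁ here (guardIfShared-atoms p _ og)
  ... | inj₂ oe = Product.map₁ there (expand-atoms ps _ oe)

  interpolant : Fm
  interpolant = expand (atoms φ) (λ _ → n)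

  interpolant-atoms : ∀ q → Occurs q interpolant → Occurs q φ × Occurs q ψ
  interpolant-atoms q o = Product.map₁ (∈-atoms⁻ φ) (expand-atoms (atoms φ) _ o)

  ⊨-interpolant : ∀ {x} → (∀ q → x q ∈ O) → D (⟦ φ ⟧ x) → x ⊨ interpolant
  ⊨-interpolant x∈O =
    expand-complete (atoms φ) x∈O (λ q o q∉φ → ⊥-elim (q∉φ (∈-atoms⁺ φ o)))

  interpolant-⊢B : (∀ y → (∀ q → y q ∈ n ∷ O) → D (⟦ φ ⟧ y) → DesB (⟦ ψ ⟧ y)) →
                   interpolant ⊢B ψ
  interpolant-⊢B D⇒ψ x h
    with y , y≈x , d ← expand-sound (atoms φ) (λ q → here refl , λ _ → n≤ₖ) (DesB⇒truth h)
    = DesB-monoₖ (⟦⟧-monoₖ ψ (λ q → proj₂ (y≈x q))) (D⇒ψ y (proj₁ ∘ y≈x) d)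

DesB? : Decidable DesB
DesB? f = no λ { (inj₁ ()) ; (inj₂ ()) }
DesB? n = no λ { (inj₁ ()) ; (inj₂ ()) }
DesB? b = yes (inj₂ refl)
DesB? t = yes (inj₁ refl)

DesT? : Decidable DesT
DesT? f = no λ ()
DesT? n = no λ ()
DesT? b = no λ ()
DesT? t = yes refl

DesT⇒DesB : ∀ {x} → DesT x → DesB x
DesT⇒DesB = inj₁

B4-values : List B4
B4-values = f ∷ n ∷ b ∷ t ∷ []

∈-B4-values : ∀ x → x ∈ B4-values
∈-B4-values f = here refl
∈-B4-values n = there (here refl)
∈-B4-values b = there (there (here refl))
∈-B4-values t = there (there (there (here refl)))

B-interpolation : Interpolation _⊢B_ _⊢B_ _⊢B_
B-interpolation φ ψ φ⊢ψ =
  interpolant ,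
  (λ x h → truth⇒DesB _ (⊨-interpolant (∈-B4-values ∘ x) h)) ,
  interpolant-⊢B (λ y _ → φ⊢ψ y) ,
  interpolant-atoms
  where open Interpolant B4-values DesB? φ ψ

Consistent : B4 → Set
Consistent x = ¬ (T (truth x) × T (falsity x))

⊓-consistent : ∀ {x y} → Consistent x → Consistent y → Consistent (x ⊓ y)
⊓-consistent {x} {y} cx cy (tr , fa) with to (T-truth-⊓ x y) tr | to (T-falsity-⊓ x y) fa
... | tx , _ | inj₁ fx = cx (tx , fx)
... | _ , ty | inj₂ fy = cy (ty , fy)

⊔-consistent : ∀ {x y} → Consistent x → Consistent y → Consistent (x ⊔ y)
⊔-consistent {x} {y} cx cy (tr , fa) with to (T-truth-⊔ x y) tr | to (T-falsity-⊔ x y) fa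
... | inj₁ tx | fx , _ = cx (tx , fx)
... | inj₂ ty | _ , fy = cy (ty , fy)

neg-consistent : ∀ {x} → Consistent x → Consistent (neg x)
neg-consistent {x} cx (tr , fa) = cx (subst T (falsity-neg x) fa , subst T (truth-neg x) tr)

⟦⟧-consistent : ∀ φ {v} → (∀ q → Consistent (v q)) → Consistent (⟦ φ ⟧ v)
⟦⟧-consistent (atom p) cv = cv p
⟦⟧-consistent (φ ∧' ψ) cv = ⊓-consistent (⟦⟧-consistent φ cv) (⟦⟧-consistent ψ cv)
⟦⟧-consistent (φ ∨' ψ) cv = ⊔-consistent (⟦⟧-consistent φ cv) (⟦⟧-consistent ψ cv)
⟦⟧-consistent (∼ φ) cv = neg-consistent (⟦⟧-consistent φ cv)
⟦⟧-consistent top cv (_ , ())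
⟦⟧-consistent bot cv (() , _)

InK3⇒consistent : ∀ {x} → InK3 x → Consistent x
InK3⇒consistent (inj₁ refl) (() , _)
InK3⇒consistent (inj₂ (inj₁ refl)) (() , _)
InK3⇒consistent (inj₂ (inj₂ refl)) (_ , ())

consistent-truth⇒DesT : ∀ x → Consistent x → T (truth x) → DesT x
consistent-truth⇒DesT b cx tx = ⊥-elim (cx (tx , tx))
consistent-truth⇒DesT t _ _ = refl

K3-values : List B4
K3-values = f ∷ n ∷ t ∷ []

InK3⇒∈ : ∀ {x} → InK3 x → x ∈ K3-values
InK3⇒∈ (inj₁ refl) = here refl
InK3⇒∈ (inj₂ (inj₁ refl)) = there (here refl)
InK3⇒∈ (inj₂ (inj₂ refl)) = there (there (here refl))

∈⇒InK3 : ∀ {x} → x ∈ n ∷ K3-values → InK3 x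
∈⇒InK3 (here refl) = inj₂ (inj₁ refl)
∈⇒InK3 (there (here refl)) = inj₁ refl
∈⇒InK3 (there (there (here refl))) = inj₂ (inj₁ refl)
∈⇒InK3 (there (there (there (here refl)))) = inj₂ (inj₂ refl)

K-interpolation : Interpolation _⊢K_ _⊢K_ _⊢B_
K-interpolation φ ψ φ⊢ψ =
  interpolant ,
  (λ x x∈K3 h → consistent-truth⇒DesT _
     (⟦⟧-consistent interpolant (InK3⇒consistent ∘ x∈K3))
     (⊨-interpolant (InK3⇒∈ ∘ x∈K3) h)) ,
  interpolant-⊢B (λ y y∈K3 d → DesT⇒DesB (φ⊢ψ y (∈⇒InK3 ∘ y∈K3) d)) ,
  interpolant-atoms
  where open Interpolant K3-values DesT? φ ψ

swap-nb : B4 → B4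
swap-nb f = f
swap-nb n = b
swap-nb b = n
swap-nb t = t

swap-nb-⊓ : ∀ x y → swap-nb (x ⊓ y) ≡ swap-nb x ⊓ swap-nb y
swap-nb-⊓ f _ = refl
swap-nb-⊓ t _ = refl
swap-nb-⊓ n f = refl
swap-nb-⊓ n n = refl
swap-nb-⊓ n b = refl
swap-nb-⊓ n t = refl
swap-nb-⊓ b f = refl
swap-nb-⊓ b n = refl
swap-nb-⊓ b b = refl
swap-nb-⊓ b t = refl

swap-nb-⊔ : ∀ x y → swap-nb (x ⊔ y) ≡ swap-nb x ⊔ swap-nb y
swap-nb-⊔ f _ = refl
swap-nb-⊔ t _ = refl
swap-nb-⊔ n f = refl
swap-nb-⊔ n n = refl
swap-nb-⊔ n b = refl
swap-nb-⊔ n t = refl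
swap-nb-⊔ b f = refl
swap-nb-⊔ b n = refl
swap-nb-⊔ b b = refl
swap-nb-⊔ b t = refl

swap-nb-neg : ∀ x → swap-nb (neg x) ≡ neg (swap-nb x)
swap-nb-neg f = refl
swap-nb-neg n = refl
swap-nb-neg b = refl
swap-nb-neg t = refl

⟦⟧-swap-nb : ∀ φ (v : ℕ → B4) → ⟦ φ ⟧ (swap-nb ∘ v) ≡ swap-nb (⟦ φ ⟧ v)
⟦⟧-swap-nb (atom p) v = refl
⟦⟧-swap-nb (φ ∧' ψ) v =
  trans (cong₂ _⊓_ (⟦⟧-swap-nb φ v) (⟦⟧-swap-nb ψ v)) (sym (swap-nb-⊓ (⟦ φ ⟧ v) (⟦ ψ ⟧ v)))
⟦⟧-swap-nb (φ ∨' ψ) v =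
  trans (cong₂ _⊔_ (⟦⟧-swap-nb φ v) (⟦⟧-swap-nb ψ v)) (sym (swap-nb-⊔ (⟦ φ ⟧ v) (⟦ ψ ⟧ v)))
⟦⟧-swap-nb (∼ φ) v = trans (cong neg (⟦⟧-swap-nb φ v)) (sym (swap-nb-neg (⟦ φ ⟧ v)))
⟦⟧-swap-nb top v = refl
⟦⟧-swap-nb bot v = refl

truth-swap-nb⇒DesT : ∀ x → T (truth x) → T (truth (swap-nb x)) → DesT x
truth-swap-nb⇒DesT t _ _ = refl

ETL-interpolation : Interpolation _⊢ETL_ _⊢ETL_ _⊢B_
ETL-interpolation φ ψ φ⊢ψ =
  interpolant ,
  ⊢interpolant ,
  interpolant-⊢B (λ y _ d → DesT⇒DesB (φ⊢ψ y d)) ,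
  interpolant-atoms
  where
  open Interpolant B4-values DesT? φ ψ
  ⊢interpolant : φ ⊢ETL interpolant
  ⊢interpolant x h = truth-swap-nb⇒DesT _
    (⊨-interpolant (∈-B4-values ∘ x) h)
    (subst (T ∘ truth) (⟦⟧-swap-nb interpolant x)
      (⊨-interpolant (∈-B4-values ∘ swap-nb ∘ x) (trans (⟦⟧-swap-nb φ x) (cong swap-nb h))))

proposition5p12 : Interpolation _⊢B_ _⊢B_ _⊢B_
                  × Interpolation _⊢K_ _⊢K_ _⊢B_
                  × Interpolation _⊢ETL_ _⊢ETL_ _⊢B_
proposition5p12 = B-interpolation , K-interpolation , ETL-interpolation
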